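{- Let $\Pi\subseteq S_3$ intersect exactly two of the sets $M_1,M_2,M_3$. Then for all $n\ge3$, $$\lceil\log_2\log_2 n\rceil+1\le p_\Pi(n)\le 2\lceil\log_2\log_2 n\rceil+2.$$
   Context: Elements of $S_3$ are written as words $abc$. Let $M_1=\{213,312\}$, $M_2=\{123,321\}$ and $M_3=\{132,231\}$. An ordering of $[n]$ is a bijection $\phi:[n]\to[n]$. A ternary constraint is a triple $\mathbf x=(x_1,x_2,x_3)$ of distinct elements of $[n]$. $\mathrm{ord}(\phi,\mathbf x)$ is the word $abc$ with $\phi(x_a)<\phi(x_b)<\phi(x_c)$. For nonempty $\Pi$, $p_\Pi(n)$ is the minimum size of a set $\Phi$ of orderings of $[n]$ such that every constraint $\mathbf x$ has some $\phi\in\Phi$ with $\mathrm{ord}(\phi,\mathbf x)\in\Pi$. -}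

module Defs where

open import Data.Nat using (ℕ; _+_; _*_)
open import Data.Nat.Logarithm using (⌈log₂_⌉)
open import Data.Bool using (Bool; true; false; _∧_; _∨_)
open import Data.Fin using (Fin; zero; suc; _<_)
open import Data.Fin.Permutation using (Permutation′; _⟨$⟩ʳ_)
open import Data.Product using (_×_; _,_; ∃; ∃-syntax)
open import Relation.Binary.PropositionalEquality using (_≡_; _≢_)

data S3 : Set where
  s123 s132 s213 s231 s312 s321 : S3

-- The letters a, b, c of a word (0-indexed: letter k is stored as k-1).
letters : S3 → Fin 3 × Fin 3 × Fin 3
letters s123 = zero , suc zero , suc (suc zero)
letters s132 = zero , suc (suc zero) , suc zero
letters s213 = suc zero , zero , suc (suc zero)
letters s231 = suc zero , suc (suc zero) , zero
letters s312 = suc (suc zero) , zero , suc zero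
letters s321 = suc (suc zero) , suc zero , zero

SubS3 : Set
SubS3 = S3 → Bool

M₁ M₂ M₃ : SubS3
M₁ s213 = true
M₁ s312 = true
M₁ _    = false
M₂ s123 = true
M₂ s321 = true
M₂ _    = false
M₃ s132 = true
M₃ s231 = true
M₃ _    = false

meets : SubS3 → SubS3 → Bool
meets A B = (A s123 ∧ B s123) ∨ (A s132 ∧ B s132) ∨ (A s213 ∧ B s213)
          ∨ (A s231 ∧ B s231) ∨ (A s312 ∧ B s312) ∨ (A s321 ∧ B s321)

b2n : Bool → ℕ
b2n true  = 1
b2n false = 0

meetsExactlyTwo : SubS3 → Set
meetsExactlyTwo Π = b2n (meets Π M₁) + b2n (meets Π M₂) + b2n (meets Π M₃) ≡ 2

Ordering : ℕ → Set
Ordering n = Permutation′ n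

record Constraint (n : ℕ) : Set where
  constructor con
  field
    x₁ x₂ x₃ : Fin n
    d₁₂ : x₁ ≢ x₂
    d₁₃ : x₁ ≢ x₃
    d₂₃ : x₂ ≢ x₃

sel : ∀ {n} → Constraint n → Fin 3 → Fin n
sel c zero = Constraint.x₁ c
sel c (suc zero) = Constraint.x₂ c
sel c (suc (suc zero)) = Constraint.x₃ c

-- ord(φ, x) ≡ w : φ(x_a) < φ(x_b) < φ(x_c) where w = abc
-- (for distinct x this determines w uniquely)
OrdIs : ∀ {n} → Ordering n → Constraint n → S3 → Set
OrdIs φ x w with letters w
... | a , b , c = ((φ ⟨$⟩ʳ sel x a) < (φ ⟨$⟩ʳ sel x b)) × ((φ ⟨$⟩ʳ sel x b) < (φ ⟨$⟩ʳ sel x c))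

Covers : ∀ {n k} → SubS3 → (Fin k → Ordering n) → Set
Covers {n} {k} Π Φ = (x : Constraint n) → ∃[ i ] ∃[ w ] (Π w ≡ true × OrdIs (Φ i) x w)

-- ⌈log₂ log₂ n⌉ for n ≥ 2, computed as ⌈log₂ ⌈log₂ n⌉⌉
-- (valid since 2^k is an integer: log₂ n ≤ 2^k ⇔ ⌈log₂ n⌉ ≤ 2^k).
⌈log₂log₂_⌉ : ℕ → ℕ
⌈log₂log₂ n ⌉ = ⌈log₂ ⌈log₂ n ⌉ ⌉

module Submission where

-- Lower bound.  Π misses some class M_j.  Given k ≤ ⌈log₂log₂ n⌉ orderings, list the points
-- in the order of the first one and apply the Erdős–Szekeres theorem once for each of the
-- others; each application takes a square root of the length, so three points a, c, b
-- survive that are monotone under every ordering: c always lies between a and b.  The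
-- constraint with c at index j then only shows patterns with middle letter j, none in Π.
--
-- Upper bound.  Give the points binary codes of length 2^L (L = ⌈log₂log₂ n⌉) and order them
-- lexicographically after complementing the code bits selected by a flip vector t.  Of
-- three codes one, at index j, separates first (at coordinate s) and the other two later
-- (at r); the flips at s and r choose whether it comes first or last and the order of the
-- other two, realizing every pattern whose middle letter is not j.  The 2L + 2 vectors
-- "constant, or a binary digit of the coordinate, possibly complemented" prescribe all
-- pairs of values at s ≠ r, and Π meets some M_i with i ≠ j.

open import Defs
open import Data.Nat using (ℕ; _+_; _*_; _≤_)
open import Data.Fin using (Fin)
open import Data.Product using (_×_; Σ; ∃-syntax)

open import Data.Bool using (Bool; true; false; _∧_; _∨_; _xor_; not; if_then_else_)
open import Data.Bool.Properties using (∨-zeroʳ; ∧-conicalˡ; ∧-conicalʳ; ¬-not; not-¬)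
import Data.Bool.Properties as Bool
open import Data.Fin using (zero; suc; toℕ; fromℕ<; inject≤; punchOut; remQuot; combine)
import Data.Fin.Properties as Fin
open import Data.Fin.Permutation using (permutation; _⟨$⟩ʳ_; _⟨$⟩ˡ_; inverseˡ; inverseʳ)
open import Data.List using (List; []; _∷_; length; map; filter; tabulate; allFin)
open import Data.List.Properties using (length-map; length-tabulate; filter-notAll)
open import Data.List.Membership.Propositional.Properties using (∈-allFin)
open import Data.List.Relation.Binary.Sublist.Propositional using (_⊆_; []; _∷_; _∷ʳ_; ⊆-refl; ⊆-trans)
open import Data.List.Relation.Binary.Sublist.Propositional.Properties using (All-resp-⊆; filter-⊆)
import Data.List.Relation.Binary.Sublist.Propositional.Properties as Sublist
open import Data.List.Relation.Unary.All as All using (All; []; _∷_)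
open import Data.List.Relation.Unary.All.Properties using (¬Any⇒All¬; all-filter; filter⁺)
open import Data.List.Relation.Unary.AllPairs as AllPairs using (AllPairs; []; _∷_)
import Data.List.Relation.Unary.AllPairs.Properties as AllPairs
open import Data.List.Relation.Unary.Any as Any using (Any; here; there; any?)
open import Data.Nat using (zero; suc; z≤n; s≤s; _<_; _∸_; _^_; _⊔_; ⌊_/2⌋; ⌈_/2⌉; _<?_; _≤?_; _≟_)
open import Data.Nat.Induction using (<-rec)
open import Data.Nat.Logarithm using (⌈log₂_⌉; ⌈log₂⌉-mono-≤; ⌈log₂2^n⌉≡n; ⌈log₂⌈n/2⌉⌉≡⌈log₂n⌉∸1)
open import Data.Nat.Properties
  using ( ≤-refl; ≤-reflexive; ≤-trans; <-trans; <-≤-trans; <-irrefl; <-asym; <-cmp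
        ; ≰⇒>; ≮⇒≥; <⇒≱; ≤∧≢⇒<; <⇒≤pred; m≤n⇒m≤1+n; m≤m+n; m≤m⊔n; m≤n⊔m; ⊔-sel
        ; +-comm; +-suc; +-identityʳ; *-suc; +-monoˡ-≤; +-mono-≤; +-monoʳ-<; +-mono-≤-<; +-cancelˡ-<
        ; ^-monoʳ-≤; ^-distribˡ-+-*; ⌊n/2⌋+⌈n/2⌉≡n; ⌊n/2⌋≤⌈n/2⌉; ⌈n/2⌉<n
        ; module ≤-Reasoning)
open import Data.Product using (_,_; proj₁; proj₂)
open import Data.Sum using (_⊎_; inj₁; inj₂)
import Data.Sum
open import Data.Vec using (Vec; []; _∷_; lookup)
open import Data.Vec.Properties using (∷-injective)
import Data.Vec.Properties as Vec
open import Function using (_∘_)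
open import Function.Definitions using (Injective)
open import Relation.Binary using (tri<; tri≈; tri>)
open import Relation.Binary.PropositionalEquality
  using (_≡_; _≢_; refl; sym; trans; cong; cong₂; subst; subst₂; module ≡-Reasoning)
open import Relation.Nullary using (¬_; yes; no; contradiction)
open import Relation.Unary using (Decidable)
open import Relation.Unary.Properties using (∁?)

-- The middle letter of a word (0-indexed); M j is exactly the set of words with middle letter j.
middle : S3 → Fin 3
middle w = proj₁ (proj₂ (letters w))

M : Fin 3 → SubS3
M zero             = M₁
M (suc zero)       = M₂
M (suc (suc zero)) = M₃

M-middle : ∀ w → M (middle w) w ≡ true
M-middle s123 = refl
M-middle s132 = refl
M-middle s213 = refl
M-middle s231 = refl
M-middle s312 = refl
M-middle s321 = refl

middle-M : ∀ j w → M j w ≡ true → middle w ≡ j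
middle-M zero             s213 _ = refl
middle-M zero             s312 _ = refl
middle-M (suc zero)       s123 _ = refl
middle-M (suc zero)       s321 _ = refl
middle-M (suc (suc zero)) s132 _ = refl
middle-M (suc (suc zero)) s231 _ = refl
middle-M zero             s123 ()
middle-M zero             s132 ()
middle-M zero             s231 ()
middle-M zero             s321 ()
middle-M (suc zero)       s132 ()
middle-M (suc zero)       s213 ()
middle-M (suc zero)       s231 ()
middle-M (suc zero)       s312 ()
middle-M (suc (suc zero)) s123 ()
middle-M (suc (suc zero)) s213 ()
middle-M (suc (suc zero)) s312 ()
middle-M (suc (suc zero)) s321 ()

∨-trueˡ : ∀ {x} y → x ≡ true → x ∨ y ≡ true
∨-trueˡ y refl = refl

∨-trueʳ : ∀ x {y} → y ≡ true → x ∨ y ≡ true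
∨-trueʳ x refl = ∨-zeroʳ x

module _ (A B : SubS3) where

  private
    both : S3 → Bool
    both w = A w ∧ B w

  both-meets : ∀ w → both w ≡ true → meets A B ≡ true
  both-meets s123 e = ∨-trueˡ _ e
  both-meets s132 e = ∨-trueʳ (both s123) (∨-trueˡ _ e)
  both-meets s213 e = ∨-trueʳ (both s123) (∨-trueʳ (both s132) (∨-trueˡ _ e))
  both-meets s231 e = ∨-trueʳ (both s123) (∨-trueʳ (both s132) (∨-trueʳ (both s213) (∨-trueˡ _ e)))
  both-meets s312 e =
    ∨-trueʳ (both s123) (∨-trueʳ (both s132) (∨-trueʳ (both s213) (∨-trueʳ (both s231) (∨-trueˡ _ e))))
  both-meets s321 e =
    ∨-trueʳ (both s123) (∨-trueʳ (both s132) (∨-trueʳ (both s213) (∨-trueʳ (both s231) (∨-trueʳ (both s312) e))))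

  meets-intro : ∀ w → A w ≡ true → B w ≡ true → meets A B ≡ true
  meets-intro w a b = both-meets w (subst₂ (λ x y → x ∧ y ≡ true) (sym a) (sym b) refl)

  meets-both : meets A B ≡ true → ∃[ w ] both w ≡ true
  meets-both e with both s123 in e₁
  ... | true = s123 , e₁
  ... | false with both s132 in e₂
  ... | true = s132 , e₂
  ... | false with both s213 in e₃
  ... | true = s213 , e₃
  ... | false with both s231 in e₄
  ... | true = s231 , e₄
  ... | false with both s312 in e₅
  ... | true = s312 , e₅
  ... | false = s321 , e

  meets-elim : meets A B ≡ true → ∃[ w ] (A w ≡ true × B w ≡ true)
  meets-elim e = let w , e′ = meets-both e in w , ∧-conicalˡ _ _ e′ , ∧-conicalʳ _ _ e′

ExactlyTwo : (Fin 3 → Bool) → Set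
ExactlyTwo f = b2n (f zero) + b2n (f (suc zero)) + b2n (f (suc (suc zero))) ≡ 2

someFalse : ∀ f → ExactlyTwo f → ∃[ j ] f j ≡ false
someFalse f two with f zero in e₀ | f (suc zero) in e₁ | f (suc (suc zero)) in e₂
... | false | _     | _     = zero , e₀
... | true  | false | _     = suc zero , e₁
... | true  | true  | false = suc (suc zero) , e₂
... | true  | true  | true  = contradiction two λ ()

trueAvoiding : ∀ f → ExactlyTwo f → ∀ j → ∃[ i ] (i ≢ j × f i ≡ true)
trueAvoiding f two with f zero in e₀ | f (suc zero) in e₁ | f (suc (suc zero)) in e₂
... | false | true  | true  = λ { zero             → suc zero , (λ ()) , e₁
                                ; (suc zero)       → suc (suc zero) , (λ ()) , e₂
                                ; (suc (suc zero)) → suc zero , (λ ()) , e₁ }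
... | true  | false | true  = λ { zero             → suc (suc zero) , (λ ()) , e₂
                                ; (suc zero)       → zero , (λ ()) , e₀
                                ; (suc (suc zero)) → zero , (λ ()) , e₀ }
... | true  | true  | false = λ { zero             → suc zero , (λ ()) , e₁
                                ; (suc zero)       → zero , (λ ()) , e₀
                                ; (suc (suc zero)) → zero , (λ ()) , e₀ }
... | false | false | false = contradiction two λ ()
... | false | false | true  = contradiction two λ ()
... | false | true  | false = contradiction two λ ()
... | true  | false | false = contradiction two λ ()
... | true  | true  | true  = contradiction two λ ()

Between : ℕ → ℕ → ℕ → Set
Between p q r = (p < q × q < r) ⊎ (r < q × q < p)

min-notBetween : ∀ {p q r} → p < q → p < r → ¬ Between q p r
min-notBetween p<q _ (inj₁ (q<p , _)) = <-asym p<q q<p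
min-notBetween _ p<r (inj₂ (r<p , _)) = <-asym p<r r<p

max-notBetween : ∀ {p q r} → q < p → r < p → ¬ Between q p r
max-notBetween _ r<p (inj₁ (_ , p<r)) = <-asym p<r r<p
max-notBetween q<p _ (inj₂ (_ , p<q)) = <-asym p<q q<p

at : ∀ {n} → Ordering n → Fin n → ℕ
at φ a = toℕ (φ ⟨$⟩ʳ a)

pos : ∀ {n} → Ordering n → Constraint n → Fin 3 → ℕ
pos φ x i = at φ (sel x i)

others : Fin 3 → Fin 3 × Fin 3
others zero             = suc zero , suc (suc zero)
others (suc zero)       = zero , suc (suc zero)
others (suc (suc zero)) = zero , suc zero

MiddleAt : ∀ {n} → Ordering n → Constraint n → Fin 3 → Set
MiddleAt φ x j = Between (pos φ x (proj₁ (others j))) (pos φ x j) (pos φ x (proj₂ (others j)))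

-- The middle letter of ord(φ, x) is the index of the point lying between the other two:
-- any other index names the least or the largest of the three positions.
middle-forced : ∀ {n} (φ : Ordering n) x j w → OrdIs φ x w → MiddleAt φ x j → middle w ≡ j
middle-forced φ x zero s213 _ _ = refl
middle-forced φ x zero s312 _ _ = refl
middle-forced φ x zero s123 (o₁ , o₂) b = contradiction b (min-notBetween o₁ (<-trans o₁ o₂))
middle-forced φ x zero s132 (o₁ , o₂) b = contradiction b (min-notBetween (<-trans o₁ o₂) o₁)
middle-forced φ x zero s231 (o₁ , o₂) b = contradiction b (max-notBetween (<-trans o₁ o₂) o₂)
middle-forced φ x zero s321 (o₁ , o₂) b = contradiction b (max-notBetween o₂ (<-trans o₁ o₂))
middle-forced φ x (suc zero) s123 _ _ = refl
middle-forced φ x (suc zero) s321 _ _ = refl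
middle-forced φ x (suc zero) s213 (o₁ , o₂) b = contradiction b (min-notBetween o₁ (<-trans o₁ o₂))
middle-forced φ x (suc zero) s231 (o₁ , o₂) b = contradiction b (min-notBetween (<-trans o₁ o₂) o₁)
middle-forced φ x (suc zero) s132 (o₁ , o₂) b = contradiction b (max-notBetween (<-trans o₁ o₂) o₂)
middle-forced φ x (suc zero) s312 (o₁ , o₂) b = contradiction b (max-notBetween o₂ (<-trans o₁ o₂))
middle-forced φ x (suc (suc zero)) s132 _ _ = refl
middle-forced φ x (suc (suc zero)) s231 _ _ = refl
middle-forced φ x (suc (suc zero)) s312 (o₁ , o₂) b = contradiction b (min-notBetween o₁ (<-trans o₁ o₂))
middle-forced φ x (suc (suc zero)) s321 (o₁ , o₂) b = contradiction b (min-notBetween (<-trans o₁ o₂) o₁)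
middle-forced φ x (suc (suc zero)) s123 (o₁ , o₂) b = contradiction b (max-notBetween (<-trans o₁ o₂) o₂)
middle-forced φ x (suc (suc zero)) s213 (o₁ , o₂) b = contradiction b (max-notBetween o₂ (<-trans o₁ o₂))

placeAt : ∀ {n} (j : Fin 3) {a c b : Fin n} → a ≢ c → a ≢ b → c ≢ b → Constraint n
placeAt zero             {a} {c} {b} a≢c a≢b c≢b = con c a b (a≢c ∘ sym) c≢b a≢b
placeAt (suc zero)       {a} {c} {b} a≢c a≢b c≢b = con a c b a≢c a≢b c≢b
placeAt (suc (suc zero)) {a} {c} {b} a≢c a≢b c≢b = con a b c a≢b a≢c (c≢b ∘ sym)

placeAt-middle : ∀ {n} (φ : Ordering n) j {a c b} (a≢c : a ≢ c) (a≢b : a ≢ b) (c≢b : c ≢ b) →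
  Between (at φ a) (at φ c) (at φ b) → MiddleAt φ (placeAt j a≢c a≢b c≢b) j
placeAt-middle φ zero             _ _ _ btw = btw
placeAt-middle φ (suc zero)       _ _ _ btw = btw
placeAt-middle φ (suc (suc zero)) _ _ _ btw = btw

module _ {A : Set} where

  AllPairs-resp-⊆ : ∀ {R : A → A → Set} {xs ys} → xs ⊆ ys → AllPairs R ys → AllPairs R xs
  AllPairs-resp-⊆ []       []       = []
  AllPairs-resp-⊆ (_ ∷ʳ τ) (_ ∷ rs) = AllPairs-resp-⊆ τ rs
  AllPairs-resp-⊆ (refl ∷ τ) (r ∷ rs) = All-resp-⊆ τ r ∷ AllPairs-resp-⊆ τ rs

  All-≡⇒AllPairs : ∀ {B : Set} {f : A → B} {v xs} →
    All (λ x → f x ≡ v) xs → AllPairs (λ x y → f x ≡ f y) xs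
  All-≡⇒AllPairs []       = []
  All-≡⇒AllPairs (e ∷ es) = All.map (λ e′ → trans e (sym e′)) es ∷ All-≡⇒AllPairs es

  length-filter-∁ : ∀ {P : A → Set} (P? : Decidable P) xs →
    length (filter P? xs) + length (filter (∁? P?) xs) ≡ length xs
  length-filter-∁ P? []       = refl
  length-filter-∁ P? (x ∷ xs) with P? x
  ... | yes _ = cong suc (length-filter-∁ P? xs)
  ... | no  _ = trans (+-suc _ _) (cong suc (length-filter-∁ P? xs))

  module _ (g : A → ℕ) where

    takes? : (v : ℕ) → Decidable (λ x → g x ≡ v)
    takes? v x = g x ≟ v

    pigeonhole : (a s : ℕ) (xs : List A) → All (λ x → g x < a) xs → a * s < length xs →
      ∃[ v ] ∃[ ys ] (ys ⊆ xs × All (λ y → g y ≡ v) ys × s < length ys)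
    pigeonhole zero    s []       []       ()
    pigeonhole zero    s (_ ∷ _)  (() ∷ _) _
    pigeonhole (suc a) s xs bounded long with s <? length (filter (takes? a) xs)
    ... | yes many = a , filter (takes? a) xs , filter-⊆ (takes? a) xs , all-filter (takes? a) xs , many
    ... | no few =
      let v , ys , τ , same , long′ = pigeonhole a s rest restBounded restLong
      in v , ys , ⊆-trans τ (filter-⊆ (∁? (takes? a)) xs) , same , long′
      where
      open ≤-Reasoning
      rest = filter (∁? (takes? a)) xs
      restBounded : All (λ x → g x < a) rest
      restBounded = All.zipWith (λ (below , ≢a) → ≤∧≢⇒< (<⇒≤pred below) ≢a)
        (filter⁺ (∁? (takes? a)) bounded , all-filter (∁? (takes? a)) xs)
      restLong : a * s < length rest
      restLong = +-cancelˡ-< s (a * s) (length rest) (<-≤-trans long (begin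
        length xs                                   ≡⟨ sym (length-filter-∁ (takes? a) xs) ⟩
        length (filter (takes? a) xs) + length rest ≤⟨ +-monoˡ-≤ (length rest) (≮⇒≥ few) ⟩
        s + length rest                             ∎))

module _ {A : Set} {P Q : A → Set} (P? : Decidable P) (Q? : Decidable Q) (P⇒Q : ∀ {x} → P x → Q x) where

  length-filter-mono : ∀ xs → length (filter P? xs) ≤ length (filter Q? xs)
  length-filter-mono []       = z≤n
  length-filter-mono (x ∷ xs) with P? x | Q? x
  ... | yes _  | yes _  = s≤s (length-filter-mono xs)
  ... | yes px | no ¬qx = contradiction (P⇒Q px) ¬qx
  ... | no _   | yes _  = m≤n⇒m≤1+n (length-filter-mono xs)
  ... | no _   | no _   = length-filter-mono xs

  length-filter-strict : ∀ xs → Any (λ x → Q x × ¬ P x) xs → length (filter P? xs) < length (filter Q? xs)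
  length-filter-strict (x ∷ xs) (here (qx , ¬px)) with P? x | Q? x
  ... | yes px | _      = contradiction px ¬px
  ... | no _   | no ¬qx = contradiction qx ¬qx
  ... | no _   | yes _  = s≤s (length-filter-mono xs)
  length-filter-strict (x ∷ xs) (there any) with P? x | Q? x
  ... | yes _  | yes _  = s≤s (length-filter-strict xs any)
  ... | yes px | no ¬qx = contradiction (P⇒Q px) ¬qx
  ... | no _   | yes _  = m≤n⇒m≤1+n (length-filter-strict xs any)
  ... | no _   | no _   = length-filter-strict xs any

-- Each element is labelled by the length of the longest increasing chain it starts;
-- a long chain is increasing, and otherwise, by pigeonhole, many elements share a
-- label, and these form a decreasing sublist.
module ErdősSzekeres {A : Set} (κ : A → ℕ) where

  Increasing Decreasing : List A → Set
  Increasing = AllPairs (λ x y → κ x < κ y)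
  Decreasing = AllPairs (λ x y → κ y < κ x)

  -- height x rest: the largest number of elements of rest that can follow x
  -- in an increasing sublist of x ∷ rest.
  height : A → List A → ℕ
  height x []         = 0
  height x (y ∷ rest) with κ x <? κ y
  ... | yes _ = height x rest ⊔ suc (height y rest)
  ... | no  _ = height x rest

  height-skip : ∀ x y rest → height x rest ≤ height x (y ∷ rest)
  height-skip x y rest with κ x <? κ y
  ... | yes _ = m≤m⊔n _ _
  ... | no  _ = ≤-refl

  height-step : ∀ x y rest → κ x < κ y → height y rest < height x (y ∷ rest)
  height-step x y rest x<y with κ x <? κ y
  ... | yes _   = m≤n⊔m _ _
  ... | no  x≮y = contradiction x<y x≮y

  increasing-cons : ∀ {x y ys} → κ x < κ y → Increasing (y ∷ ys) → Increasing (x ∷ y ∷ ys)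
  increasing-cons x<y inc@(y<ys ∷ _) = (x<y ∷ All.map (<-trans x<y) y<ys) ∷ inc

  chain : ∀ x rest → ∃[ ys ] (ys ⊆ rest × Increasing (x ∷ ys) × length ys ≡ height x rest)
  chain x []         = [] , [] , [] ∷ [] , refl
  chain x (y ∷ rest) with κ x <? κ y
  ... | no _ = let ys , τ , inc , len = chain x rest in ys , y ∷ʳ τ , inc , len
  ... | yes x<y with ⊔-sel (height x rest) (suc (height y rest))
  ...   | inj₁ e = let ys , τ , inc , len = chain x rest in ys , y ∷ʳ τ , inc , trans len (sym e)
  ...   | inj₂ e = let ys , τ , inc , len = chain y rest
                   in y ∷ ys , refl ∷ τ , increasing-cons x<y inc , trans (cong suc len) (sym e)

  labelled : List A → List (A × ℕ)
  labelled []         = []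
  labelled (x ∷ rest) = (x , height x rest) ∷ labelled rest

  labelled-elements : ∀ xs → map proj₁ (labelled xs) ≡ xs
  labelled-elements []       = refl
  labelled-elements (x ∷ xs) = cong (x ∷_) (labelled-elements xs)

  length-labelled : ∀ xs → length (labelled xs) ≡ length xs
  length-labelled xs = trans (sym (length-map proj₁ (labelled xs))) (cong length (labelled-elements xs))

  labelled-chain : ∀ xs → All (λ (_ , h) → ∃[ ys ] (ys ⊆ xs × Increasing ys × length ys ≡ suc h)) (labelled xs)
  labelled-chain []         = []
  labelled-chain (x ∷ rest) =
    (let ys , τ , inc , len = chain x rest in x ∷ ys , refl ∷ τ , inc , cong suc len)
    ∷ All.map (λ (ys , τ , inc , len) → ys , x ∷ʳ τ , inc , len) (labelled-chain rest)

  height-above : ∀ x rest → All (λ (y , h) → κ x < κ y → h < height x rest) (labelled rest)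
  height-above x []         = []
  height-above x (y ∷ rest) =
    height-step x y rest
    ∷ All.map (λ below x<z → <-≤-trans (below x<z) (height-skip x y rest)) (height-above x rest)

  labelled-decreasing : ∀ xs → AllPairs (λ (x , h) (y , h′) → κ x < κ y → h′ < h) (labelled xs)
  labelled-decreasing []         = []
  labelled-decreasing (x ∷ rest) = height-above x rest ∷ labelled-decreasing rest

  labelled-distinct : ∀ {xs} → AllPairs (λ x y → κ x ≢ κ y) xs →
    AllPairs (λ (x , _) (y , _) → κ x ≢ κ y) (labelled xs)
  labelled-distinct {xs} distinct =
    AllPairs.map⁻ (subst (AllPairs (λ x y → κ x ≢ κ y)) (sym (labelled-elements xs)) distinct)

  equalLabels-decreasing : ∀ {x y h h′} → ((κ x < κ y → h′ < h) × κ x ≢ κ y) × h ≡ h′ → κ y < κ x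
  equalLabels-decreasing {x} {y} ((grows , x≢y) , refl) with κ x <? κ y
  ... | yes x<y = contradiction (grows x<y) (<-irrefl refl)
  ... | no  x≮y = ≤∧≢⇒< (≮⇒≥ x≮y) (x≢y ∘ sym)

  equalLabels-sublist : ∀ {xs cs v} → AllPairs (λ x y → κ x ≢ κ y) xs → cs ⊆ labelled xs →
    All (λ (_ , h) → h ≡ v) cs → Decreasing (map proj₁ cs)
  equalLabels-sublist {xs} distinct τ same = AllPairs.map⁺ (AllPairs.zipWith equalLabels-decreasing
    (AllPairs.zip (AllPairs-resp-⊆ τ (labelled-decreasing xs) , AllPairs-resp-⊆ τ (labelled-distinct distinct)) ,
     All-≡⇒AllPairs same))

  erdősSzekeres : ∀ a xs → AllPairs (λ x y → κ x ≢ κ y) xs → a * a < length xs →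
    ∃[ ys ] (ys ⊆ xs × a < length ys × (Increasing ys ⊎ Decreasing ys))
  erdősSzekeres a xs distinct long with any? (λ (_ , h) → a ≤? h) (labelled xs)
  ... | yes tall =
    let (ys , τ , inc , len) , a≤h = All.lookupAny (labelled-chain xs) tall
    in ys , τ , subst (a <_) (sym len) (s≤s a≤h) , inj₁ inc
  ... | no short =
    let v , cs , τ , same , long′ = pigeonhole proj₂ a a (labelled xs) bounded
                                      (subst (a * a <_) (sym (length-labelled xs)) long)
    in map proj₁ cs ,
       subst (map proj₁ cs ⊆_) (labelled-elements xs) (Sublist.map⁺ proj₁ τ) ,
       subst (a <_) (sym (length-map proj₁ cs)) long′ ,
       inj₂ (equalLabels-sublist distinct τ same)
    where
    bounded : All (λ (_ , h) → h < a) (labelled xs)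
    bounded = All.map ≰⇒> (¬Any⇒All¬ (labelled xs) short)

at-injective : ∀ {n} (φ : Ordering n) {a b} → at φ a ≡ at φ b → a ≡ b
at-injective φ {a} {b} e = begin
  a                     ≡⟨ sym (inverseˡ φ) ⟩
  φ ⟨$⟩ˡ (φ ⟨$⟩ʳ a)     ≡⟨ cong (φ ⟨$⟩ˡ_) (Fin.toℕ-injective e) ⟩
  φ ⟨$⟩ˡ (φ ⟨$⟩ʳ b)     ≡⟨ inverseˡ φ ⟩
  b                     ∎
  where open ≡-Reasoning

module _ {n : ℕ} where
  open ErdősSzekeres

  Monotone : Ordering n → List (Fin n) → Set
  Monotone φ ys = Increasing (at φ) ys ⊎ Decreasing (at φ) ys

  Monotone-resp-⊆ : ∀ {φ xs ys} → xs ⊆ ys → Monotone φ ys → Monotone φ xs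
  Monotone-resp-⊆ τ (inj₁ inc) = inj₁ (AllPairs-resp-⊆ τ inc)
  Monotone-resp-⊆ τ (inj₂ dec) = inj₂ (AllPairs-resp-⊆ τ dec)

  monotone-between : ∀ {φ a c b rest} → Monotone φ (a ∷ c ∷ b ∷ rest) → Between (at φ a) (at φ c) (at φ b)
  monotone-between (inj₁ ((a<c ∷ _) ∷ (c<b ∷ _) ∷ _)) = inj₁ (a<c , c<b)
  monotone-between (inj₂ ((c<a ∷ _) ∷ (b<c ∷ _) ∷ _)) = inj₂ (b<c , c<a)

  -- Iterated Erdős–Szekeres: each ordering takes a square root of the length,
  -- so more than 2^(2^j) distinct points contain a sublist of at least three points
  -- monotone under each of j orderings.
  monotoneUnderAll : ∀ j (ψ : Fin j → Ordering n) xs → AllPairs _≢_ xs → 2 ^ (2 ^ j) < length xs →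
    ∃[ ys ] (ys ⊆ xs × 2 < length ys × (∀ i → Monotone (ψ i) ys))
  monotoneUnderAll zero    ψ xs _        long = xs , ⊆-refl , long , λ ()
  monotoneUnderAll (suc j) ψ xs distinct long =
    let ys , τ , long′ , mono = erdősSzekeres (at (ψ zero)) (2 ^ (2 ^ j)) xs
                                  (AllPairs.map (λ a≢b → a≢b ∘ at-injective (ψ zero)) distinct)
                                  (subst (_< length xs) (square j) long)
        zs , σ , long″ , mono′ = monotoneUnderAll j (ψ ∘ suc) ys (AllPairs-resp-⊆ τ distinct) long′
    in zs , ⊆-trans σ τ , long″ , λ { zero → Monotone-resp-⊆ {ψ zero} σ mono ; (suc i) → mono′ i }
    where
    square : ∀ i → 2 ^ (2 ^ suc i) ≡ 2 ^ (2 ^ i) * 2 ^ (2 ^ i)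
    square i = trans (cong (λ e → 2 ^ (2 ^ i + e)) (+-identityʳ (2 ^ i))) (^-distribˡ-+-* 2 (2 ^ i) (2 ^ i))

  before⇒≢ : ∀ {φ : Ordering n} {a b} → at φ a < at φ b → a ≢ b
  before⇒≢ a<b refl = <-irrefl refl a<b

  increasing-distinct : ∀ {φ : Ordering n} {xs} → Increasing (at φ) xs → AllPairs _≢_ xs
  increasing-distinct {φ} = AllPairs.map (before⇒≢ {φ})

  firstThree-distinct : ∀ {φ : Ordering n} {a c b rest} → Increasing (at φ) (a ∷ c ∷ b ∷ rest) →
    a ≢ c × a ≢ b × c ≢ b
  firstThree-distinct {φ} ((a<c ∷ a<b ∷ _) ∷ (c<b ∷ _) ∷ _) =
    before⇒≢ {φ} a<c , before⇒≢ {φ} a<b , before⇒≢ {φ} c<b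

  sortedBy : Ordering n → List (Fin n)
  sortedBy φ = tabulate (φ ⟨$⟩ˡ_)

  sortedBy-increasing : ∀ φ → Increasing (at φ) (sortedBy φ)
  sortedBy-increasing φ = AllPairs.tabulate⁺-< λ i<j →
    subst₂ _<_ (sym (cong toℕ (inverseʳ φ))) (sym (cong toℕ (inverseʳ φ))) i<j

  -- For k + 1 orderings of more than 2^(2^k) points, some point c lies between two
  -- others a and b under every one of them: list the points in the order of the
  -- first ordering and apply  monotoneUnderAll  to the remaining k.
  betweenUnderAll : ∀ k (Φ : Fin (suc k) → Ordering n) → 2 ^ (2 ^ k) < n →
    ∃[ a ] ∃[ c ] ∃[ b ] (a ≢ c × a ≢ b × c ≢ b × (∀ i → Between (at (Φ i) a) (at (Φ i) c) (at (Φ i) b)))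
  betweenUnderAll k Φ long
    with monotoneUnderAll k (Φ ∘ suc) (sortedBy (Φ zero))
           (increasing-distinct {Φ zero} (sortedBy-increasing (Φ zero)))
           (subst (2 ^ (2 ^ k) <_) (sym (length-tabulate _)) long)
  ... | _ ∷ [] , _ , s≤s () , _
  ... | _ ∷ _ ∷ [] , _ , s≤s (s≤s ()) , _
  ... | a ∷ c ∷ b ∷ rest , τ , _ , mono =
    let inc = AllPairs-resp-⊆ τ (sortedBy-increasing (Φ zero))
        a≢c , a≢b , c≢b = firstThree-distinct {Φ zero} inc
    in a , c , b , a≢c , a≢b , c≢b , λ { zero    → monotone-between {Φ zero} (inj₁ inc)
                                       ; (suc i) → monotone-between {Φ (suc i)} (mono i) }

⌈log₂⌉-≤ : ∀ {m} k → m ≤ 2 ^ k → ⌈log₂ m ⌉ ≤ k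
⌈log₂⌉-≤ {m} k m≤2^k = subst (⌈log₂ m ⌉ ≤_) (⌈log₂2^n⌉≡n k) (⌈log₂⌉-mono-≤ m≤2^k)

<⌈log₂⌉⇒2^< : ∀ {m k} → k < ⌈log₂ m ⌉ → 2 ^ k < m
<⌈log₂⌉⇒2^< {k = k} k<log = ≰⇒> (λ m≤2^k → <⇒≱ k<log (⌈log₂⌉-≤ k m≤2^k))

-- n ≤ 2^⌈log₂ n⌉, by halving: N ≤ 2⌈N/2⌉ and ⌈log₂ ⌈N/2⌉⌉ = ⌈log₂ N⌉ - 1.
≤2^⌈log₂⌉ : ∀ n → n ≤ 2 ^ ⌈log₂ n ⌉
≤2^⌈log₂⌉ = <-rec _ go
  where
  go : ∀ n → (∀ {m} → m < n → m ≤ 2 ^ ⌈log₂ m ⌉) → n ≤ 2 ^ ⌈log₂ n ⌉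
  go zero          _   = z≤n
  go (suc zero)    _   = s≤s z≤n
  go (suc (suc n)) rec = begin
    N                 ≡⟨ sym (⌊n/2⌋+⌈n/2⌉≡n N) ⟩
    ⌊ N /2⌋ + h       ≤⟨ +-monoˡ-≤ h (⌊n/2⌋≤⌈n/2⌉ N) ⟩
    h + h             ≤⟨ +-mono-≤ h≤P h≤P ⟩
    P + P             ≡⟨ cong (P +_) (sym (+-identityʳ P)) ⟩
    2 ^ suc (ℓ ∸ 1)   ≡⟨ cong (2 ^_) (suc-pred ℓ≥1) ⟩
    2 ^ ℓ             ∎
    where
    open ≤-Reasoning
    N = suc (suc n)
    h = ⌈ N /2⌉
    ℓ = ⌈log₂ N ⌉
    P = 2 ^ (ℓ ∸ 1)
    h≤P : h ≤ P
    h≤P = subst (λ e → h ≤ 2 ^ e) (⌈log₂⌈n/2⌉⌉≡⌈log₂n⌉∸1 N) (rec (⌈n/2⌉<n n))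
    ℓ≥1 : 1 ≤ ℓ
    ℓ≥1 = subst (_≤ ℓ) (⌈log₂2^n⌉≡n 1) (⌈log₂⌉-mono-≤ {2} {N} (s≤s (s≤s z≤n)))
    suc-pred : ∀ {x} → 1 ≤ x → suc (x ∸ 1) ≡ x
    suc-pred {suc x} _ = refl

-- Lower bound: Π misses some class M j, and against at most ⌈log₂log₂ n⌉ orderings some
-- constraint has its j-th point in the middle under all of them (with no orderings at
-- all, any constraint is uncovered).
fewOrderingsFail : ∀ Π → meetsExactlyTwo Π → ∀ {n} → 3 ≤ n → ∀ k (Φ : Fin k → Ordering n) →
  k ≤ ⌈log₂log₂ n ⌉ → ¬ Covers Π Φ
fewOrderingsFail Π two (s≤s (s≤s (s≤s _))) zero Φ _ cov
  with () , _ ← cov (con zero (suc zero) (suc (suc zero)) (λ ()) (λ ()) (λ ()))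
fewOrderingsFail Π two _ (suc k) Φ k<L cov =
  let a , c , b , a≢c , a≢b , c≢b , between = betweenUnderAll k Φ (<⌈log₂⌉⇒2^< (<⌈log₂⌉⇒2^< k<L))
      j , missed = someFalse (λ j → meets Π (M j)) two
      i , w , Πw , ord = cov (placeAt j a≢c a≢b c≢b)
      middle≡j = middle-forced (Φ i) _ j w ord (placeAt-middle (Φ i) j a≢c a≢b c≢b (between i))
      met = meets-intro Π (M j) w Πw (subst (λ m → M m w ≡ true) middle≡j (M-middle w))
  in contradiction (trans (sym missed) met) λ ()

lowerBound : ∀ Π → meetsExactlyTwo Π → ∀ n → 3 ≤ n →
  (k : ℕ) (Φ : Fin k → Ordering n) → Covers Π Φ → ⌈log₂log₂ n ⌉ + 1 ≤ k
lowerBound Π two n 3≤n k Φ cov =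
  subst (_≤ k) (+-comm 1 ⌈log₂log₂ n ⌉) (≰⇒> (λ k≤L → fewOrderingsFail Π two 3≤n k Φ k≤L cov))

-- An injective map Fin n → Fin n misses no point: otherwise it would inject Fin n into Fin (n - 1).
injective⇒surjective : ∀ {n} {f : Fin n → Fin n} → Injective _≡_ _≡_ f → ∀ y → ∃[ x ] f x ≡ y
injective⇒surjective {suc n} {f} f-inj y with Fin.any? (λ x → f x Fin.≟ y)
... | yes hit  = hit
... | no  miss = contradiction (Fin.injective⇒≤ punched-injective) (<-irrefl refl)
  where
  y≢f : ∀ x → y ≢ f x
  y≢f x y≡fx = miss (x , sym y≡fx)
  punched-injective : Injective _≡_ _≡_ (λ x → punchOut (y≢f x))
  punched-injective e = f-inj (Fin.punchOut-injective (y≢f _) (y≢f _) e)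

module _ {n : ℕ} where

  asOrdering : (f : Fin n → Fin n) → Injective _≡_ _≡_ f → Ordering n
  asOrdering f f-inj = permutation f f⁻¹ (λ y → proj₂ (onto y)) (λ x → f-inj (proj₂ (onto (f x))))
    where
    onto = injective⇒surjective f-inj
    f⁻¹ = λ y → proj₁ (onto y)

  module _ (κ : Fin n → ℕ) (κ-inj : Injective _≡_ _≡_ κ) where

    rank : Fin n → ℕ
    rank x = length (filter (λ y → κ y <? κ x) (allFin n))

    rank<n : ∀ x → rank x < n
    rank<n x = subst (rank x <_) (length-tabulate _)
      (filter-notAll (λ y → κ y <? κ x) (allFin n)
        (Any.map (λ { refl → <-irrefl refl }) (∈-allFin x)))

    rank-mono : ∀ {a b} → κ a < κ b → rank a < rank b
    rank-mono {a} {b} a<b = length-filter-strict (λ y → κ y <? κ a) (λ y → κ y <? κ b)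
      (λ y<a → <-trans y<a a<b) (allFin n) (Any.map (λ { refl → a<b , <-irrefl refl }) (∈-allFin a))

    rankFin : Fin n → Fin n
    rankFin x = fromℕ< (rank<n x)

    rankFin-mono : ∀ {a b} → κ a < κ b → toℕ (rankFin a) < toℕ (rankFin b)
    rankFin-mono {a} {b} a<b =
      subst₂ _<_ (sym (Fin.toℕ-fromℕ< (rank<n a))) (sym (Fin.toℕ-fromℕ< (rank<n b))) (rank-mono a<b)

    rankFin-injective : Injective _≡_ _≡_ rankFin
    rankFin-injective {a} {b} e with <-cmp (κ a) (κ b)
    ... | tri< a<b _ _ = contradiction (rankFin-mono a<b) (<-irrefl (cong toℕ e))
    ... | tri≈ _ a≡b _ = κ-inj a≡b
    ... | tri> _ _ b<a = contradiction (rankFin-mono b<a) (<-irrefl (cong toℕ (sym e)))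

    orderingBy : Ordering n
    orderingBy = asOrdering rankFin rankFin-injective

    orderingBy-mono : ∀ {a b} → κ a < κ b → at orderingBy a < at orderingBy b
    orderingBy-mono = rankFin-mono

bool-other : ∀ {x y z : Bool} → x ≢ z → y ≢ z → x ≡ y
bool-other x≢z y≢z = trans (¬-not x≢z) (sym (¬-not y≢z))

toBit : Fin 2 → Bool
toBit zero       = false
toBit (suc zero) = true

toBit-injective : Injective _≡_ _≡_ toBit
toBit-injective {zero}     {zero}     _  = refl
toBit-injective {suc zero} {suc zero} _  = refl
toBit-injective {zero}     {suc zero} ()
toBit-injective {suc zero} {zero}     ()

toBit-onto : ∀ b → ∃[ c ] toBit c ≡ b
toBit-onto false = zero , refl
toBit-onto true  = suc zero , refl

-- The binary expansion (most significant bit first) of the elements of Fin 2^m.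
binary : ∀ m → Fin (2 ^ m) → Vec Bool m
binary zero    _ = []
binary (suc m) i = let q , r = remQuot (2 ^ m) i in toBit q ∷ binary m r

binary-injective : ∀ m → Injective _≡_ _≡_ (binary m)
binary-injective zero    {zero} {zero} _ = refl
binary-injective (suc m) {i}    {j}    e =
  let q≡ , r≡ = ∷-injective e
  in begin
    i                                   ≡⟨ sym (Fin.combine-remQuot (2 ^ m) i) ⟩
    combine (proj₁ (remQuot (2 ^ m) i)) (proj₂ (remQuot (2 ^ m) i))
      ≡⟨ cong₂ combine (toBit-injective q≡) (binary-injective m r≡) ⟩
    combine (proj₁ (remQuot (2 ^ m) j)) (proj₂ (remQuot (2 ^ m) j))
      ≡⟨ Fin.combine-remQuot (2 ^ m) j ⟩
    j                                   ∎
  where open ≡-Reasoning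

data FirstDiff : ∀ {m} → Fin m → Vec Bool m → Vec Bool m → Set where
  here  : ∀ {m x y} {u v : Vec Bool m} → x ≢ y → FirstDiff zero (x ∷ u) (y ∷ v)
  there : ∀ {m x s} {u v : Vec Bool m} → FirstDiff s u v → FirstDiff (suc s) (x ∷ u) (x ∷ v)

∷-≢⁻ : ∀ {m x} {u v : Vec Bool m} → x ∷ u ≢ x ∷ v → u ≢ v
∷-≢⁻ {x = x} ne = ne ∘ cong (x ∷_)

firstDiff : ∀ {m} {u v : Vec Bool m} → u ≢ v → ∃[ s ] FirstDiff s u v
firstDiff {u = []}    {[]}    u≢v = contradiction refl u≢v
firstDiff {u = x ∷ u} {y ∷ v} u≢v with x Bool.≟ y
... | no  x≢y  = zero , here x≢y
... | yes refl = let s , d = firstDiff (∷-≢⁻ u≢v) in suc s , there d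

FirstDiff-sym : ∀ {m s} {u v : Vec Bool m} → FirstDiff s u v → FirstDiff s v u
FirstDiff-sym (here x≢y) = here (x≢y ∘ sym)
FirstDiff-sym (there d)  = there (FirstDiff-sym d)

FirstDiff-differs : ∀ {m s} {u v : Vec Bool m} → FirstDiff s u v → lookup u s ≢ lookup v s
FirstDiff-differs (here x≢y) = x≢y
FirstDiff-differs (there d)  = FirstDiff-differs d

lexKey : ∀ {m} → (Fin m → Bool) → Vec Bool m → ℕ
lexKey         t []      = 0
lexKey {suc m} t (x ∷ u) = (if t zero xor x then 2 ^ m else 0) + lexKey (t ∘ suc) u

digit≤ : ∀ b h → (if b then h else 0) ≤ h
digit≤ true  h = ≤-refl
digit≤ false h = z≤n

lexKey<2^m : ∀ {m} t (u : Vec Bool m) → lexKey t u < 2 ^ m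
lexKey<2^m         t []      = s≤s z≤n
lexKey<2^m {suc m} t (x ∷ u) = subst (lexKey t (x ∷ u) <_) (cong (2 ^ m +_) (sym (+-identityʳ (2 ^ m))))
  (+-mono-≤-< (digit≤ (t zero xor x) (2 ^ m)) (lexKey<2^m (t ∘ suc) u))

precedes : ∀ {m s} {u v : Vec Bool m} t → FirstDiff s u v → t s ≡ lookup u s → lexKey t u < lexKey t v
precedes {suc m} {u = x ∷ u} {y ∷ v} t (here x≢y) ts≡x rewrite ts≡x with x | y
... | false | true  = <-≤-trans (lexKey<2^m (t ∘ suc) u) (m≤m+n (2 ^ m) _)
... | true  | false = <-≤-trans (lexKey<2^m (t ∘ suc) u) (m≤m+n (2 ^ m) _)
... | false | false = contradiction refl x≢y
... | true  | true  = contradiction refl x≢y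
precedes t (there d) e = +-monoʳ-< _ (precedes (t ∘ suc) d e)

follows : ∀ {m s} {u v : Vec Bool m} t → FirstDiff s u v → t s ≢ lookup u s → lexKey t v < lexKey t u
follows t d ts≢us = precedes t (FirstDiff-sym d) (bool-other ts≢us (FirstDiff-differs d ∘ sym))

lexKey-injective : ∀ {m} t → Injective _≡_ _≡_ (lexKey {m} t)
lexKey-injective t {u} {v} e with Vec.≡-dec Bool._≟_ u v
... | yes u≡v = u≡v
... | no  u≢v with firstDiff u≢v
...   | s , d with t s Bool.≟ lookup u s
...     | yes agree    = contradiction (precedes t d agree) (<-irrefl e)
...     | no  disagree = contradiction (follows t d disagree) (<-irrefl (sym e))

Split : ∀ {m} → Vec Bool m → Vec Bool m → Vec Bool m → Set
Split u v w = ∃[ s ] ∃[ r ] (FirstDiff s u v × FirstDiff s u w × FirstDiff r v w)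

Split-swap : ∀ {m} {u v w : Vec Bool m} → Split u v w → Split u w v
Split-swap (s , r , uv , uw , vw) = s , r , uw , uv , FirstDiff-sym vw

Split-there : ∀ {m x} {u v w : Vec Bool m} → Split u v w → Split (x ∷ u) (x ∷ v) (x ∷ w)
Split-there (s , r , uv , uw , vw) = suc s , suc r , there uv , there uw , there vw

-- The two separation coordinates differ: at s the vectors v, w still agree.
Split-coordinates : ∀ {m} {u v w : Vec Bool m} → ((s , r , _) : Split u v w) → s ≢ r
Split-coordinates (s , .s , uv , uw , vw) refl =
  FirstDiff-differs vw (bool-other (FirstDiff-differs uv ∘ sym) (FirstDiff-differs uw ∘ sym))

-- Among three distinct bit vectors one separates first: compare the leading bits, and
-- recurse on the tails when they all agree.
split : ∀ {m} {u v w : Vec Bool m} → u ≢ v → u ≢ w → v ≢ w → Split u v w ⊎ Split v u w ⊎ Split w u v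
split {u = []} {[]} {[]} u≢v _ _ = contradiction refl u≢v
split {u = x ∷ u} {y ∷ v} {z ∷ w} u≢v u≢w v≢w with x Bool.≟ y | x Bool.≟ z | y Bool.≟ z
... | yes refl | yes refl | _ =
  Data.Sum.map Split-there (Data.Sum.map Split-there Split-there) (split (∷-≢⁻ u≢v) (∷-≢⁻ u≢w) (∷-≢⁻ v≢w))
... | yes refl | no x≢z | _ =
  let r , uv = firstDiff (∷-≢⁻ u≢v)
  in inj₂ (inj₂ (zero , suc r , here (x≢z ∘ sym) , here (x≢z ∘ sym) , there uv))
... | no x≢y | yes refl | _ =
  let r , uw = firstDiff (∷-≢⁻ u≢w)
  in inj₂ (inj₁ (zero , suc r , here (x≢y ∘ sym) , here (x≢y ∘ sym) , there uw))
... | no x≢y | no x≢z | yes refl =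
  let r , vw = firstDiff (∷-≢⁻ v≢w)
  in inj₁ (zero , suc r , here x≢y , here x≢z , there vw)
... | no x≢y | no x≢z | no y≢z = contradiction (bool-other (x≢y ∘ sym) (x≢z ∘ sym)) y≢z

TwoIndependent : ∀ {k m} → (Fin k → Fin m → Bool) → Set
TwoIndependent {m = m} T = ∀ {s r : Fin m} → s ≢ r → ∀ α β → ∃[ i ] (T i s ≡ α × T i r ≡ β)

flipBit : ∀ {p q α β} → p ≢ q → α ≢ β → ∃[ c ] (toBit c xor p ≡ α × toBit c xor q ≡ β)
flipBit {false} {false} p≢q _   = contradiction refl p≢q
flipBit {true}  {true}  p≢q _   = contradiction refl p≢q
flipBit {α = false} {false} _ α≢β = contradiction refl α≢β
flipBit {α = true}  {true}  _ α≢β = contradiction refl α≢β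
flipBit {false} {true}  {false} {true}  _ _ = zero , refl , refl
flipBit {false} {true}  {true}  {false} _ _ = suc zero , refl , refl
flipBit {true}  {false} {false} {true}  _ _ = suc zero , refl , refl
flipBit {true}  {false} {true}  {false} _ _ = zero , refl , refl

flipVector : ∀ L → Fin 2 × Fin (suc L) → Fin (2 ^ L) → Bool
flipVector L (c , zero)  s = toBit c
flipVector L (c , suc q) s = toBit c xor lookup (binary L s) q

flipFamily : ∀ L → Fin (2 * suc L) → Fin (2 ^ L) → Bool
flipFamily L i = flipVector L (remQuot (suc L) i)

flipFamily-combine : ∀ L c r s → flipFamily L (combine c r) s ≡ flipVector L (c , r) s
flipFamily-combine L c r s = cong (λ cr → flipVector L cr s) (Fin.remQuot-combine c r)

-- Equal target values come from a constant vector; distinct ones from a binary digit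
-- in which the two coordinates differ.
flipFamily-independent : ∀ L → TwoIndependent (flipFamily L)
flipFamily-independent L {s} {r} s≢r α β with α Bool.≟ β
... | yes refl =
  let c , c≡α = toBit-onto α
  in combine c zero , trans (flipFamily-combine L c zero s) c≡α , trans (flipFamily-combine L c zero r) c≡α
... | no α≢β =
  let q , d = firstDiff (s≢r ∘ binary-injective L)
      c , on-s , on-r = flipBit (FirstDiff-differs d) α≢β
  in combine c (suc q) , trans (flipFamily-combine L c (suc q) s) on-s , trans (flipFamily-combine L c (suc q) r) on-r

size-flipFamily : ∀ L → 2 * suc L ≤ 2 * L + 2
size-flipFamily L = ≤-reflexive (trans (*-suc 2 L) (+-comm 2 (2 * L)))

module FlipCover {n m k : ℕ} (code : Fin n → Vec Bool m) (code-injective : Injective _≡_ _≡_ code)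
                 (T : Fin k → Fin m → Bool) (T-independent : TwoIndependent T) where

  key : Fin k → Fin n → ℕ
  key i = lexKey (T i) ∘ code

  key-injective : ∀ i → Injective _≡_ _≡_ (key i)
  key-injective i = code-injective ∘ lexKey-injective (T i)

  Φ : Fin k → Ordering n
  Φ i = orderingBy (key i) (key-injective i)

  Φ-mono : ∀ i {a b} → key i a < key i b → at (Φ i) a < at (Φ i) b
  Φ-mono i = orderingBy-mono (key i) (key-injective i)

  -- If a's code separates first from those of b and c, then a can be put first
  -- or last, with b before c, by choosing the flips at the two separation coordinates.
  oddFirst : ∀ {a b c} → Split (code a) (code b) (code c) →
    ∃[ i ] (at (Φ i) a < at (Φ i) b × at (Φ i) b < at (Φ i) c)
  oddFirst {a} {b} sp@(s , r , ab , _ , bc) =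
    let i , ts , tr = T-independent (Split-coordinates sp) (lookup (code a) s) (lookup (code b) r)
    in i , Φ-mono i (precedes (T i) ab ts) , Φ-mono i (precedes (T i) bc tr)

  oddLast : ∀ {a b c} → Split (code a) (code b) (code c) →
    ∃[ i ] (at (Φ i) b < at (Φ i) c × at (Φ i) c < at (Φ i) a)
  oddLast {a} {b} sp@(s , r , _ , ac , bc) =
    let i , ts , tr = T-independent (Split-coordinates sp) (not (lookup (code a) s)) (lookup (code b) r)
    in i , Φ-mono i (precedes (T i) bc tr) ,
           Φ-mono i (follows (T i) ac (λ ts≡as → not-¬ refl (trans (sym ts≡as) ts)))

  OddAt : Constraint n → Fin 3 → Set
  OddAt x j = Split (code (sel x j)) (code (sel x (proj₁ (others j)))) (code (sel x (proj₂ (others j))))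

  oddAt : ∀ x → ∃[ j ] OddAt x j
  oddAt (con _ _ _ d₁₂ d₁₃ d₂₃)
    with split (d₁₂ ∘ code-injective) (d₁₃ ∘ code-injective) (d₂₃ ∘ code-injective)
  ... | inj₁ sp        = zero , sp
  ... | inj₂ (inj₁ sp) = suc zero , sp
  ... | inj₂ (inj₂ sp) = suc (suc zero) , sp

  realize : ∀ x j → OddAt x j → ∀ w → middle w ≢ j → ∃[ i ] OrdIs (Φ i) x w
  realize x zero             sp s123 _ = oddFirst sp
  realize x zero             sp s132 _ = oddFirst (Split-swap sp)
  realize x zero             sp s231 _ = oddLast sp
  realize x zero             sp s321 _ = oddLast (Split-swap sp)
  realize x (suc zero)       sp s213 _ = oddFirst sp
  realize x (suc zero)       sp s231 _ = oddFirst (Split-swap sp)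
  realize x (suc zero)       sp s132 _ = oddLast sp
  realize x (suc zero)       sp s312 _ = oddLast (Split-swap sp)
  realize x (suc (suc zero)) sp s312 _ = oddFirst sp
  realize x (suc (suc zero)) sp s321 _ = oddFirst (Split-swap sp)
  realize x (suc (suc zero)) sp s123 _ = oddLast sp
  realize x (suc (suc zero)) sp s213 _ = oddLast (Split-swap sp)
  realize x zero             _ s213 ≢j = contradiction refl ≢j
  realize x zero             _ s312 ≢j = contradiction refl ≢j
  realize x (suc zero)       _ s123 ≢j = contradiction refl ≢j
  realize x (suc zero)       _ s321 ≢j = contradiction refl ≢j
  realize x (suc (suc zero)) _ s132 ≢j = contradiction refl ≢j
  realize x (suc (suc zero)) _ s231 ≢j = contradiction refl ≢j

  covers : ∀ Π → (∀ j → ∃[ i ] (i ≢ j × meets Π (M i) ≡ true)) → Covers Π Φ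
  covers Π avoiding x =
    let j , sp = oddAt x
        i , i≢j , met = avoiding j
        w , Πw , Miw = meets-elim Π (M i) met
        ℓ , ord = realize x j sp w (i≢j ∘ trans (sym (middle-M i w Miw)))
    in ℓ , w , Πw , ord

upperBound : ∀ Π → meetsExactlyTwo Π → ∀ n →
  ∃[ k ] ((k ≤ 2 * ⌈log₂log₂ n ⌉ + 2) × Σ (Fin k → Ordering n) (λ Φ → Covers Π Φ))
upperBound Π two n =
  2 * suc L , size-flipFamily L , Cover.Φ , Cover.covers Π (trueAvoiding (λ j → meets Π (M j)) two)
  where
  L = ⌈log₂log₂ n ⌉
  fits : n ≤ 2 ^ (2 ^ L)
  fits = ≤-trans (≤2^⌈log₂⌉ n) (^-monoʳ-≤ 2 (≤2^⌈log₂⌉ ⌈log₂ n ⌉))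
  code : Fin n → Vec Bool (2 ^ L)
  code x = binary (2 ^ L) (inject≤ x fits)
  code-injective : Injective _≡_ _≡_ code
  code-injective e = Fin.inject≤-injective fits fits _ _ (binary-injective (2 ^ L) e)
  module Cover = FlipCover code code-injective (flipFamily L) (flipFamily-independent L)

lemma4p6 : (Π : SubS3) → meetsExactlyTwo Π → (n : ℕ) → 3 ≤ n →
    ((k : ℕ) (Φ : Fin k → Ordering n) → Covers Π Φ → ⌈log₂log₂ n ⌉ + 1 ≤ k)
    × (∃[ k ] ((k ≤ 2 * ⌈log₂log₂ n ⌉ + 2) × Σ (Fin k → Ordering n) (λ Φ → Covers Π Φ)))
lemma4p6 Π two n 3≤n = lowerBound Π two n 3≤n , upperBound Π two n
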